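{- Let $S$ be a regularly linearly ordered monoid, let $A$ be a regular $S$-polygon and let $a\in A$. Then the set $\{Sb\mid b\in A,\ Sb\subseteq Sa\}$ is linearly ordered by inclusion.
   Context: Let $S$ be a monoid. A (left) $S$-polygon is a set $A$ with an action $S\times A\to A$ satisfying $s_1(s_2a)=(s_1s_2)a$ and $1a=a$; for $a\in A$, $Sa=\{sa\mid s\in S\}$. An element $a\in A$ is act-regular if there is a polygon homomorphism $\varphi:Sa\to S$ (with $S$ acting on itself by left multiplication) such that $\varphi(a)a=a$; equivalently $Sa\cong Se$ for some idempotent $e\in S$ via an isomorphism sending $a$ to $e$. $A$ is regular if every element is act-regular. The regular core $R$ of $S$ is the set of $a\in S$ such that the polygon $Sa$ is regular (assumed nonempty). $S$ is regularly linearly ordered if for every $a\in R$ the set $\{Sb\mid b\in S,\ Sb\subseteq Sa\}$ is linearly ordered by inclusion. -}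

module Defs where

open import Data.Product using (Σ; ∃; _×_; _,_)
open import Data.Sum using (_⊎_)
open import Relation.Binary.PropositionalEquality using (_≡_; sym)

record Monoid : Set₁ where
  infixl 7 _∙_
  field
    Carrier : Set
    _∙_     : Carrier → Carrier → Carrier
    ε       : Carrier
    assoc   : ∀ x y z → (x ∙ y) ∙ z ≡ x ∙ (y ∙ z)
    identityˡ : ∀ x → ε ∙ x ≡ x
    identityʳ : ∀ x → x ∙ ε ≡ x

module _ (S : Monoid) where
  open Monoid S renaming (Carrier to ∣S∣)

  record Polygon : Set₁ where
    infixr 6 _·_
    field
      Carrier : Set
      _·_     : ∣S∣ → Carrier → Carrier
      act-assoc : ∀ s₁ s₂ a → s₁ · (s₂ · a) ≡ (s₁ ∙ s₂) · a
      act-ε     : ∀ a → ε · a ≡ a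

  leftRegular : Polygon
  leftRegular = record
    { Carrier = ∣S∣ ; _·_ = _∙_
    ; act-assoc = λ s₁ s₂ a → sym (assoc s₁ s₂ a)
    ; act-ε = identityˡ }

  module _ (A : Polygon) where
    open Polygon A renaming (Carrier to ∣A∣)

    _∈S_ : ∣A∣ → ∣A∣ → Set
    x ∈S a = ∃ λ s → x ≡ s · a

    _S⊆S_ : ∣A∣ → ∣A∣ → Set
    b S⊆S a = ∀ x → x ∈S b → x ∈S a

    -- a is act-regular: there is a polygon homomorphism φ : Sa → S
    -- (a function on the set Sa commuting with the action) with φ(a) a = a.
    IsActRegular : ∣A∣ → Set
    IsActRegular a =
      Σ ((Σ ∣A∣ λ x → x ∈S a) → ∣S∣) λ φ →
        (∀ s x (p : x ∈S a) (q : (s · x) ∈S a) → φ (s · x , q) ≡ s ∙ φ (x , p))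
        × (∀ (p : a ∈S a) → φ (a , p) · a ≡ a)

    IsRegular : Set
    IsRegular = ∀ a → IsActRegular a

    LinearlyOrderedBelow : ∣A∣ → Set
    LinearlyOrderedBelow a =
      ∀ b c → b S⊆S a → c S⊆S a → b S⊆S c ⊎ c S⊆S b

  -- The regular core R of S: a ∈ R iff the polygon Sa (a subpolygon of S)
  -- is regular, i.e. every x ∈ Sa is act-regular.  Act-regularity of x
  -- only depends on the cyclic subpolygon Sx ⊆ Sa, so it is the same
  -- whether computed in Sa or in S.
  InRegularCore : ∣S∣ → Set
  InRegularCore a = ∀ x → _∈S_ leftRegular x a → IsActRegular leftRegular x

  RegularCoreNonempty : Set
  RegularCoreNonempty = ∃ λ a → InRegularCore a

  IsRegularlyLinearlyOrdered : Set
  IsRegularlyLinearlyOrdered =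
    ∀ a → InRegularCore a → LinearlyOrderedBelow leftRegular a

-- Let e = φ(a) for a homomorphism φ : Sa → S with φ(a) a = a.  The polygon map
-- y ↦ y a from S to A restricts to an isomorphism Se ≅ Sa with inverse φ.  Each
-- x ∈ Se is act-regular because its image x a ∈ A is and the map is injective on
-- Sx ⊆ Se; so e lies in the regular core, and the linear order of the cyclic
-- subpolygons of Se is carried over to those of Sa.
module Submission where

open import Defs
open import Data.Product using (Σ; _,_; proj₁; proj₂)
import Data.Sum as Sum
open import Relation.Binary.PropositionalEquality

module _ {S : Monoid} where
  open Monoid S renaming (Carrier to ∣S∣)

  module _ (A : Polygon S) where
    open Polygon A renaming (Carrier to ∣A∣)

    ∈S-refl : ∀ x → _∈S_ S A x x
    ∈S-refl x = ε , sym (act-ε x)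

    ∈S-trans : ∀ {x y z} → _∈S_ S A x y → _∈S_ S A y z → _∈S_ S A x z
    ∈S-trans (r , refl) (s , refl) = r ∙ s , act-assoc r s _

    ∈S⇒S⊆S : ∀ {y z} → _∈S_ S A y z → _S⊆S_ S A y z
    ∈S⇒S⊆S y∈z x x∈y = ∈S-trans x∈y y∈z

    IsCyclicHom : (a : ∣A∣) → ((Σ ∣A∣ λ x → _∈S_ S A x a) → ∣S∣) → Set
    IsCyclicHom a φ =
      ∀ s x (p : _∈S_ S A x a) (q : _∈S_ S A (s · x) a) → φ (s · x , q) ≡ s ∙ φ (x , p)

    cyclicHom-≡ : ∀ {a φ} → IsCyclicHom a φ →
                  ∀ s {x y} (p : _∈S_ S A x a) (q : _∈S_ S A y a) →
                  y ≡ s · x → φ (y , q) ≡ s ∙ φ (x , p)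
    cyclicHom-≡ hom s p q refl = hom s _ p q

  module _ (B A : Polygon S) where
    open Polygon B renaming (Carrier to ∣B∣; _·_ to _·ᴮ_)
    open Polygon A renaming (Carrier to ∣A∣)

    IsPolygonHom : (∣B∣ → ∣A∣) → Set
    IsPolygonHom f = ∀ s x → f (s ·ᴮ x) ≡ s · f x

    module _ {f : ∣B∣ → ∣A∣} (f-hom : IsPolygonHom f) where

      ∈S-map : ∀ {x y} → _∈S_ S B x y → _∈S_ S A (f x) (f y)
      ∈S-map {y = y} (r , refl) = r , f-hom r y

      S⊆S-map : ∀ {x y} → _S⊆S_ S B x y → _S⊆S_ S A (f x) (f y)
      S⊆S-map {x} {y} x⊆y _ (r , refl) with x⊆y (r ·ᴮ x) (r , refl)
      ... | v , rx≡vy = v , (begin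
        r · f x     ≡⟨ sym (f-hom r x) ⟩
        f (r ·ᴮ x)  ≡⟨ cong f rx≡vy ⟩
        f (v ·ᴮ y)  ≡⟨ f-hom v y ⟩
        v · f y     ∎)
        where open ≡-Reasoning

      actRegular-reflect : ∀ x →
        (∀ {u v} → _∈S_ S B u x → _∈S_ S B v x → f u ≡ f v → u ≡ v) →
        IsActRegular S A (f x) → IsActRegular S B x
      actRegular-reflect x f-inj (φ , φ-hom , φ-fix) = ψ , ψ-hom , ψ-fix
        where
        ψ : (Σ ∣B∣ λ y → _∈S_ S B y x) → ∣S∣
        ψ (y , y∈x) = φ (f y , ∈S-map y∈x)

        ψ-hom : IsCyclicHom B x ψ
        ψ-hom s y p q = cyclicHom-≡ A φ-hom s (∈S-map p) (∈S-map q) (f-hom s y)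

        ψ-fix : ∀ (p : _∈S_ S B x x) → ψ (x , p) ·ᴮ x ≡ x
        ψ-fix p = f-inj (ψ (x , p) , refl) p
          (trans (f-hom (ψ (x , p)) x) (φ-fix (∈S-map p)))

  module AtRegular (A : Polygon S) (reg : IsRegular S A) (a : Polygon.Carrier A) where
    open Polygon A renaming (Carrier to ∣A∣)

    private
      Sₗ : Polygon S
      Sₗ = leftRegular S

      φ : (Σ ∣A∣ λ x → _∈S_ S A x a) → ∣S∣
      φ = proj₁ (reg a)

    ·a-hom : IsPolygonHom Sₗ A (_· a)
    ·a-hom s y = sym (act-assoc s y a)

    e : ∣S∣
    e = φ (a , ∈S-refl A a)

    te·a≡t·a : ∀ t → (t ∙ e) · a ≡ t · a
    te·a≡t·a t = trans (sym (act-assoc t e a))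
                               (cong (t ·_) (proj₂ (proj₂ (reg a)) (∈S-refl A a)))

    φ-leftInverse : ∀ {y z} (p : _∈S_ S A z a) → _∈S_ S Sₗ y e → z ≡ y · a →
                    φ (z , p) ≡ y
    φ-leftInverse p (r , refl) z≡ya =
      cyclicHom-≡ A (proj₁ (proj₂ (reg a))) r (∈S-refl A a) p
                  (trans z≡ya (te·a≡t·a r))

    ·a-injective-on-Se : ∀ {u v} → _∈S_ S Sₗ u e → _∈S_ S Sₗ v e → u · a ≡ v · a → u ≡ v
    ·a-injective-on-Se u∈e@(r , refl) v∈e ua≡va =
      trans (sym (φ-leftInverse ua∈a u∈e refl)) (φ-leftInverse ua∈a v∈e ua≡va)
      where
      ua∈a : _∈S_ S A ((r ∙ e) · a) a
      ua∈a = r , te·a≡t·a r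

    e-inRegularCore : InRegularCore S e
    e-inRegularCore x x∈e =
      actRegular-reflect Sₗ A ·a-hom x
        (λ u∈x v∈x → ·a-injective-on-Se (∈S-trans Sₗ u∈x x∈e) (∈S-trans Sₗ v∈x x∈e))
        (reg (x · a))

    S⊆S-fromSe : ∀ t u → _S⊆S_ S Sₗ (t ∙ e) (u ∙ e) → _S⊆S_ S A (t · a) (u · a)
    S⊆S-fromSe t u te⊆ue =
      subst₂ (_S⊆S_ S A) (te·a≡t·a t) (te·a≡t·a u)
             (S⊆S-map Sₗ A ·a-hom te⊆ue)

proposition2p5 : (S : Monoid) → RegularCoreNonempty S →
    IsRegularlyLinearlyOrdered S →
    (A : Polygon S) → IsRegular S A →
    (a : Polygon.Carrier A) → LinearlyOrderedBelow S A a
proposition2p5 S _ rlo A reg a b c b⊆a c⊆a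
  with b⊆a b (∈S-refl A b) | c⊆a c (∈S-refl A c)
... | t , refl | u , refl =
  Sum.map (S⊆S-fromSe t u) (S⊆S-fromSe u t)
    (rlo e e-inRegularCore (t ∙ e) (u ∙ e)
         (∈S⇒S⊆S (leftRegular S) (t , refl)) (∈S⇒S⊆S (leftRegular S) (u , refl)))
  where
  open Monoid S
  open AtRegular A reg a
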